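{- For $i\in\{1,2\}$, let $G_i$ be a graph with maximum degree $\Delta_i$ and degeneracy $d_i$ that contains $K_{s_i,t_i}$ as a subgraph, where $s_i,t_i$ are positive integers with $s_i\leq t_i$. Then $$\max\{d_1d_2,\ \min\{s_1t_2,s_2t_1\},\ \min\{\Delta_1,\Delta_2\}\}\leq \operatorname{degen}(G_1\times G_2)\leq \min\{d_1\Delta_2,\ d_2\Delta_1\}.$$
   Context: All graphs are finite and simple. The degeneracy $\operatorname{degen}(G)$ of a graph $G$ is the minimum integer $d$ such that every subgraph of $G$ has minimum degree at most $d$. The direct product $G_1\times G_2$ has vertex set $V(G_1)\times V(G_2)$, with $(a,v)(b,u)$ an edge iff $ab\in E(G_1)$ and $uv\in E(G_2)$. -}

module Defs where

open import Data.Nat using (ℕ; zero; suc; _+_; _*_; _≤_)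
open import Data.Bool using (Bool; true; false; if_then_else_; _∧_)
open import Data.Fin using (Fin; zero; suc; remQuot)
open import Data.Product using (Σ; _×_; _,_; ∃; proj₁; proj₂)
open import Relation.Binary.PropositionalEquality using (_≡_; _≢_)
open import Function using (_∘_)

record Graph : Set where
  field
    n      : ℕ
    adj    : Fin n → Fin n → Bool
    sym    : ∀ u v → adj u v ≡ adj v u
    irrefl : ∀ v → adj v v ≡ false
open Graph public

countᵇ : ∀ {n} → (Fin n → Bool) → ℕ
countᵇ {zero}  f = 0
countᵇ {suc n} f = (if f zero then 1 else 0) + countᵇ (f ∘ suc)

degree : (G : Graph) → Fin (n G) → ℕ
degree G v = countᵇ (adj G v)

IsMaxDegree : Graph → ℕ → Set
IsMaxDegree G Δ =
  (∀ v → degree G v ≤ Δ) × (∀ Δ' → (∀ v → degree G v ≤ Δ') → Δ ≤ Δ')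

record Subgraph (G : Graph) : Set where
  field
    S      : Fin (n G) → Bool
    E      : Fin (n G) → Fin (n G) → Bool
    E-sym  : ∀ u v → E u v ≡ E v u
    E⊆adj  : ∀ u v → E u v ≡ true → adj G u v ≡ true
    E⊆S    : ∀ u v → E u v ≡ true → S u ≡ true
open Subgraph public

degreeIn : {G : Graph} → Subgraph G → Fin (n G) → ℕ
degreeIn H v = countᵇ (E H v)

MinDegreeAtMost : {G : Graph} → Subgraph G → ℕ → Set
MinDegreeAtMost {G} H d =
  (∃ λ v → S H v ≡ true) → ∃ λ v → (S H v ≡ true) × (degreeIn H v ≤ d)

IsDegeneracy : Graph → ℕ → Set
IsDegeneracy G d =
  (∀ (H : Subgraph G) → MinDegreeAtMost H d) ×
  (∀ d' → (∀ (H : Subgraph G) → MinDegreeAtMost H d') → d ≤ d')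

ContainsKst : Graph → ℕ → ℕ → Set
ContainsKst G s t =
  Σ (Fin s → Fin (n G)) λ f → Σ (Fin t → Fin (n G)) λ g →
    (∀ i i' → f i ≡ f i' → i ≡ i') ×
    (∀ j j' → g j ≡ g j' → j ≡ j') ×
    (∀ i j → f i ≢ g j) ×
    (∀ i j → adj G (f i) (g j) ≡ true)

-- Direct (tensor) product: vertex set Fin (n₁ * n₂) ≅ Fin n₁ × Fin n₂ via remQuot.
_×ᵍ_ : Graph → Graph → Graph
G₁ ×ᵍ G₂ = record
  { n      = n G₁ * n G₂
  ; adj    = λ x y → adjP (remQuot (n G₂) x) (remQuot (n G₂) y)
  ; sym    = λ x y → symP (remQuot (n G₂) x) (remQuot (n G₂) y)
  ; irrefl = λ x → irrP (remQuot (n G₂) x)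
  }
  where
  adjP : Fin (n G₁) × Fin (n G₂) → Fin (n G₁) × Fin (n G₂) → Bool
  adjP (a , u) (b , v) = adj G₁ a b ∧ adj G₂ u v
  symP : ∀ p q → adjP p q ≡ adjP q p
  symP (a , u) (b , v) rewrite Graph.sym G₁ a b | Graph.sym G₂ u v = Relation.Binary.PropositionalEquality.refl
    where import Relation.Binary.PropositionalEquality
  irrP : ∀ p → adjP p p ≡ false
  irrP (a , u) rewrite irrefl G₁ a = Relation.Binary.PropositionalEquality.refl
    where import Relation.Binary.PropositionalEquality

-- A vertex set W in which every vertex has at least k neighbours inside W (a k-core) forces
-- degeneracy at least k, and conversely a graph of degeneracy d has a d-core. Cores multiply in
-- the direct product: W₁ × W₂ is a d₁d₂-core. Bicliques (A₁, B₁) in G₁ and (A₂, B₂) in G₂ give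
-- the core (A₁ × B₂) ∪ (B₁ × A₂), in which a vertex of either rectangle sees the whole other
-- one; taking the K_{s,t}'s, respectively the stars at vertices of maximum degree, gives the
-- other two lower bounds. For the upper bound, project a subgraph H of G₁ × G₂ to G₁: the
-- projection has a vertex a with at most d₁ neighbours inside it, and every H-neighbour of a
-- vertex (a, u) of H lies in that neighbourhood times N(u), so (a, u) has degree at most d₁Δ₂.

module Submission where

open import Defs hiding (sym)
open import Data.Nat using (ℕ; zero; suc; _+_; _*_; _≤_; _⊔_; _⊓_; z≤n; s≤s; _≤?_)
open import Data.Nat.Properties
  using (≤-refl; ≤-trans; ≤-reflexive; +-mono-≤; *-mono-≤; +-assoc; +-suc; m≤n+m; 1+n≰n;
         ≰⇒>; *-comm; *-zeroʳ; *-identityˡ; *-identityʳ; ⊔-lub; ⊓-glb; ⊓-mono-≤; ⊓-comm;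
         m⊓n≤m; m⊓n≤n; +-0-monoid; module ≤-Reasoning)
open import Algebra.Properties.Monoid.Sum +-0-monoid using (sum)
open import Data.Bool using (Bool; true; false; if_then_else_; _∧_; _∨_)
open import Data.Bool.Properties
  using (∧-conicalˡ; ∧-conicalʳ; ∨-zeroʳ) renaming (_≟_ to _≟ᵇ_)
open import Data.Fin using (Fin; zero; suc; combine; quotient; remainder; _↑ˡ_; _↑ʳ_)
open import Data.Fin.Properties
  using (_≟_; any?; all?; ¬∀⟶∃¬; remQuot-combine; suc-injective; 0≢1+n)
open import Data.Fin.Subset.Properties using (anySubset?)
open import Data.Vec using (lookup; tabulate)
open import Data.Vec.Properties using (lookup∘tabulate)
open import Data.Product using (_×_; _,_; ∃; ∃₂; proj₁; proj₂; map₂)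
open import Function using (_∘_)
open import Relation.Nullary using (Dec; yes; no; ¬_; does; contradiction)
open import Relation.Nullary.Decidable using (map′; dec-true; dec-false; _×-dec_; _→-dec_)
open import Relation.Binary.PropositionalEquality
  using (_≡_; refl; sym; trans; cong; cong₂; subst; subst₂)

does-true : ∀ {A : Set} (a? : Dec A) → does a? ≡ true → A
does-true (yes a) _ = a

indicator-mono : ∀ {a b} → (a ≡ true → b ≡ true) →
                 (if a then 1 else 0) ≤ (if b then 1 else 0)
indicator-mono {false} _ = z≤n
indicator-mono {true} a⇒b rewrite a⇒b refl = ≤-refl

countᵇ-mono : ∀ {m} {f g : Fin m → Bool} → (∀ i → f i ≡ true → g i ≡ true) →
              countᵇ f ≤ countᵇ g
countᵇ-mono {zero} _ = z≤n
countᵇ-mono {suc m} f⊆g = +-mono-≤ (indicator-mono (f⊆g zero)) (countᵇ-mono (f⊆g ∘ suc))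

countᵇ-mono-< : ∀ {m} {f g : Fin m → Bool} (z : Fin m) → (∀ i → f i ≡ true → g i ≡ true) →
                f z ≡ false → g z ≡ true → suc (countᵇ f) ≤ countᵇ g
countᵇ-mono-< zero f⊆g fz gz rewrite fz | gz = s≤s (countᵇ-mono (f⊆g ∘ suc))
countᵇ-mono-< {f = f} (suc z) f⊆g fz gz =
  ≤-trans (≤-reflexive (sym (+-suc _ (countᵇ (f ∘ suc)))))
          (+-mono-≤ (indicator-mono (f⊆g zero)) (countᵇ-mono-< z (f⊆g ∘ suc) fz gz))

countᵇ-none : ∀ {m} {f : Fin m → Bool} → (∀ i → ¬ f i ≡ true) → countᵇ f ≡ 0
countᵇ-none {zero} _ = refl
countᵇ-none {suc m} {f} none with f zero in f0
... | true  = contradiction f0 (none zero)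
... | false = countᵇ-none (none ∘ suc)

countᵇ-witness : ∀ {m} {f : Fin m → Bool} (z : Fin m) → f z ≡ true → 1 ≤ countᵇ f
countᵇ-witness zero fz rewrite fz = s≤s z≤n
countᵇ-witness {f = f} (suc z) fz =
  ≤-trans (countᵇ-witness z fz) (m≤n+m _ (if f zero then 1 else 0))

1≤countᵇ⇒∃ : ∀ {m} (f : Fin m → Bool) → 1 ≤ countᵇ f → ∃ λ z → f z ≡ true
1≤countᵇ⇒∃ {suc m} f pos with f zero in f0
... | true  = zero , f0
... | false with 1≤countᵇ⇒∃ (f ∘ suc) pos
...   | z , fz = suc z , fz

countᵇ-++ : ∀ m {k} (f : Fin (m + k) → Bool) →
            countᵇ f ≡ countᵇ (λ i → f (i ↑ˡ k)) + countᵇ (λ j → f (m ↑ʳ j))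
countᵇ-++ zero f = refl
countᵇ-++ (suc m) f = trans (cong ((if f zero then 1 else 0) +_) (countᵇ-++ m (f ∘ suc)))
                            (sym (+-assoc (if f zero then 1 else 0) _ _))

countᵇ-combine : ∀ {m k} (F : Fin (m * k) → Bool) →
                 countᵇ F ≡ sum {m} (λ a → countᵇ (λ u → F (combine a u)))
countᵇ-combine {zero} F = refl
countᵇ-combine {suc m} {k} F =
  trans (countᵇ-++ k F)
        (cong (countᵇ (λ u → F (u ↑ˡ m * k)) +_) (countᵇ-combine {m} {k} (λ y → F (k ↑ʳ y))))

sum-mono-≤ : ∀ {m} {f g : Fin m → ℕ} → (∀ i → f i ≤ g i) → sum f ≤ sum g
sum-mono-≤ {zero} _ = z≤n
sum-mono-≤ {suc m} f≤g = +-mono-≤ (f≤g zero) (sum-mono-≤ (f≤g ∘ suc))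

sum-if : ∀ {m} (R : Fin m → Bool) (c : ℕ) → sum (λ a → if R a then c else 0) ≡ countᵇ R * c
sum-if {zero} R c = refl
sum-if {suc m} R c with R zero
... | true  = cong (c +_) (sum-if (R ∘ suc) c)
... | false = sum-if (R ∘ suc) c

module _ {m k : ℕ} where

  quotient-combine : ∀ (a : Fin m) (u : Fin k) → quotient k (combine a u) ≡ a
  quotient-combine a u = cong proj₁ (remQuot-combine a u)

  remainder-combine : ∀ (a : Fin m) (u : Fin k) → remainder {m} k (combine a u) ≡ u
  remainder-combine a u = cong proj₂ (remQuot-combine a u)

  countᵇ-≤-rectangle : (F : Fin (m * k) → Bool) (R : Fin m → Bool) (R′ : Fin k → Bool) →
    (∀ y → F y ≡ true → R (quotient k y) ≡ true × R′ (remainder {m} k y) ≡ true) →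
    countᵇ F ≤ countᵇ R * countᵇ R′
  countᵇ-≤-rectangle F R R′ F⊆R×R′ = begin
    countᵇ F                                        ≡⟨ countᵇ-combine {m} {k} F ⟩
    sum {m} (λ a → countᵇ (λ u → F (combine a u)))  ≤⟨ sum-mono-≤ row-≤ ⟩
    sum {m} (λ a → if R a then countᵇ R′ else 0)    ≡⟨ sum-if R (countᵇ R′) ⟩
    countᵇ R * countᵇ R′                            ∎
    where
    open ≤-Reasoning
    row-⊆ : ∀ a u → F (combine a u) ≡ true → R a ≡ true × R′ u ≡ true
    row-⊆ a u Fau = subst₂ (λ b v → R b ≡ true × R′ v ≡ true)
      (quotient-combine a u) (remainder-combine a u) (F⊆R×R′ (combine a u) Fau)
    row-≤ : ∀ a → countᵇ (λ u → F (combine a u)) ≤ (if R a then countᵇ R′ else 0)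
    row-≤ a with R a in Ra
    ... | true  = countᵇ-mono (λ u Fau → proj₂ (row-⊆ a u Fau))
    ... | false = ≤-reflexive (countᵇ-none λ u Fau →
                    contradiction (trans (sym (proj₁ (row-⊆ a u Fau))) Ra) λ ())

  rectangle-≤-countᵇ : (F : Fin (m * k) → Bool) (R : Fin m → Bool) (R′ : Fin k → Bool) →
    (∀ y → R (quotient k y) ≡ true → R′ (remainder {m} k y) ≡ true → F y ≡ true) →
    countᵇ R * countᵇ R′ ≤ countᵇ F
  rectangle-≤-countᵇ F R R′ R×R′⊆F = begin
    countᵇ R * countᵇ R′                            ≡⟨ sum-if R (countᵇ R′) ⟨
    sum {m} (λ a → if R a then countᵇ R′ else 0)    ≤⟨ sum-mono-≤ row-≤ ⟩
    sum {m} (λ a → countᵇ (λ u → F (combine a u)))  ≡⟨ countᵇ-combine {m} {k} F ⟨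
    countᵇ F                                        ∎
    where
    open ≤-Reasoning
    row-⊆ : ∀ a u → R a ≡ true → R′ u ≡ true → F (combine a u) ≡ true
    row-⊆ a u Ra R′u = R×R′⊆F (combine a u)
      (subst (λ b → R b ≡ true) (sym (quotient-combine a u)) Ra)
      (subst (λ v → R′ v ≡ true) (sym (remainder-combine a u)) R′u)
    row-≤ : ∀ a → (if R a then countᵇ R′ else 0) ≤ countᵇ (λ u → F (combine a u))
    row-≤ a with R a in Ra
    ... | true  = countᵇ-mono (λ u → row-⊆ a u Ra)
    ... | false = z≤n

image : ∀ {s m} → (Fin s → Fin m) → (Fin s → Bool) → Fin m → Bool
image f S b = does (any? λ i → (S i ≟ᵇ true) ×-dec (f i ≟ b))

image-intro : ∀ {s m} (f : Fin s → Fin m) (S : Fin s → Bool) {i} → S i ≡ true →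
              image f S (f i) ≡ true
image-intro f S {i} Si = dec-true (any? _) (i , Si , refl)

image-elim : ∀ {s m} (f : Fin s → Fin m) (S : Fin s → Bool) {b} → image f S b ≡ true →
             ∃ λ i → S i ≡ true × f i ≡ b
image-elim f S = does-true (any? _)

range : ∀ {s m} → (Fin s → Fin m) → Fin m → Bool
range f = image f (λ _ → true)

countᵇ-range : ∀ {s m} (f : Fin s → Fin m) → (∀ i j → f i ≡ f j → i ≡ j) →
               s ≤ countᵇ (range f)
countᵇ-range {zero} f _ = z≤n
countᵇ-range {suc s} f f-inj =
  ≤-trans (s≤s (countᵇ-range (f ∘ suc) λ i j e → suc-injective (f-inj (suc i) (suc j) e)))
          (countᵇ-mono-< (f zero) tail⊆ fresh (image-intro f (λ _ → true) {zero} refl))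
  where
  tail⊆ : ∀ b → range (f ∘ suc) b ≡ true → range f b ≡ true
  tail⊆ b e with image-elim (f ∘ suc) (λ _ → true) e
  ... | i , _ , refl = image-intro f (λ _ → true) {suc i} refl
  fresh : range (f ∘ suc) (f zero) ≡ false
  fresh = dec-false (any? λ i → (true ≟ᵇ true) ×-dec (f (suc i) ≟ f zero))
                    λ (i , _ , e) → 0≢1+n (f-inj zero (suc i) (sym e))

induced : (G : Graph) → (Fin (n G) → Bool) → Subgraph G
induced G W = record
  { S     = W
  ; E     = λ a b → W a ∧ W b ∧ adj G a b
  ; E-sym = E-sym′
  ; E⊆adj = λ a b e → ∧-conicalʳ (W b) _ (∧-conicalʳ (W a) _ e)
  ; E⊆S   = λ a b e → ∧-conicalˡ (W a) _ e
  }
  where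
  E-sym′ : ∀ a b → W a ∧ W b ∧ adj G a b ≡ W b ∧ W a ∧ adj G b a
  E-sym′ a b with W a | W b
  ... | true  | true  = Graph.sym G a b
  ... | true  | false = refl
  ... | false | true  = refl
  ... | false | false = refl

edge-in-subgraph : ∀ {G} (H : Subgraph G) {v w} → E H v w ≡ true →
                   S H w ≡ true × adj G v w ≡ true
edge-in-subgraph H {v} {w} e = E⊆S H w v (trans (E-sym H w v) e) , E⊆adj H v w e

degreeIn-≤ : ∀ {G} (H : Subgraph G) v → degreeIn H v ≤ countᵇ (λ w → S H w ∧ adj G v w)
degreeIn-≤ H v = countᵇ-mono {f = E H v} λ w e →
  let (Sw , vw) = edge-in-subgraph H e in cong₂ _∧_ Sw vw

low-degree-vertex : ∀ {G d} → IsDegeneracy G d → (W : Fin (n G) → Bool) →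
                    (∃ λ a → W a ≡ true) →
                    ∃ λ a → W a ≡ true × countᵇ (λ b → W b ∧ adj G a b) ≤ d
low-degree-vertex {G} {d} (min-deg≤d , _) W nonempty with min-deg≤d (induced G W) nonempty
... | a , Wa , deg≤d = a , Wa , subst (λ w → countᵇ (λ b → w ∧ W b ∧ adj G a b) ≤ d) Wa deg≤d

max-degree-vertex : ∀ {G k} → IsMaxDegree G (suc k) → ∃ λ v → suc k ≤ degree G v
max-degree-vertex {G} {k} (_ , minimal) =
  map₂ ≰⇒> (¬∀⟶∃¬ (n G) (λ v → degree G v ≤ k) (λ v → degree G v ≤? k)
                   λ all≤k → 1+n≰n (minimal k all≤k))

IsCore : (G : Graph) → ℕ → (Fin (n G) → Bool) → Set
IsCore G k W =
  (∃ λ v → W v ≡ true) × (∀ v → W v ≡ true → k ≤ countᵇ (λ w → W w ∧ adj G v w))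

HasCore : Graph → ℕ → Set
HasCore G k = ∃ (IsCore G k)

core-≤-degeneracy : ∀ {G d k} → IsDegeneracy G d → HasCore G k → k ≤ d
core-≤-degeneracy degen (W , nonempty , k≤deg) with low-degree-vertex degen W nonempty
... | a , Wa , deg≤d = ≤-trans (k≤deg a Wa) deg≤d

IsCore-≗ : ∀ {G k} {W W′ : Fin (n G) → Bool} → (∀ v → W v ≡ W′ v) →
           IsCore G k W → IsCore G k W′
IsCore-≗ {G} W≗W′ ((v , Wv) , k≤deg) =
  (v , trans (sym (W≗W′ v)) Wv) ,
  λ u W′u → ≤-trans (k≤deg u (trans (W≗W′ u) W′u))
                    (countᵇ-mono λ w → subst (λ b → b ∧ adj G u w ≡ true) (W≗W′ w))

isCore? : ∀ G k W → Dec (IsCore G k W)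
isCore? G k W = any? (λ v → W v ≟ᵇ true)
          ×-dec all? (λ v → (W v ≟ᵇ true) →-dec (k ≤? countᵇ (λ w → W w ∧ adj G v w)))

hasCore? : ∀ G k → Dec (HasCore G k)
hasCore? G k =
  map′ (λ (V , core) → lookup V , core)
       (λ (W , core) → tabulate W , IsCore-≗ {G} {k} (λ v → sym (lookup∘tabulate W v)) core)
       (anySubset? (isCore? G k ∘ lookup))

no-core⇒min-degree≤ : ∀ {G k} → ¬ HasCore G (suc k) → (H : Subgraph G) → MinDegreeAtMost H k
no-core⇒min-degree≤ {G} {k} no-core H nonempty
  with any? (λ v → (S H v ≟ᵇ true) ×-dec (countᵇ (λ w → S H w ∧ adj G v w) ≤? k))
... | yes (v , Sv , small) = v , Sv , ≤-trans (degreeIn-≤ H v) small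
... | no none = contradiction (S H , nonempty , λ v Sv → ≰⇒> λ small → none (v , Sv , small))
                             no-core

-- Minimality alone only refutes the absence of a core; searching all vertex subsets (hasCore?)
-- turns that into an actual core.
degeneracy-core : ∀ {G k} → IsDegeneracy G (suc k) → HasCore G (suc k)
degeneracy-core {G} {k} (_ , minimal) with hasCore? G (suc k)
... | yes core   = core
... | no no-core = contradiction (minimal k (no-core⇒min-degree≤ no-core)) 1+n≰n

Biclique : (G : Graph) → (A B : Fin (n G) → Bool) → Set
Biclique G A B = ∀ a b → A a ≡ true → B b ≡ true → adj G a b ≡ true

Kst-biclique : ∀ {G s t} → ContainsKst G s t →
  ∃₂ λ A B → Biclique G A B × s ≤ countᵇ A × t ≤ countᵇ B
Kst-biclique {G} (f , g , f-inj , g-inj , _ , f~g) =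
  range f , range g , complete , countᵇ-range f f-inj , countᵇ-range g g-inj
  where
  complete : Biclique G (range f) (range g)
  complete a b fa gb with image-elim f (λ _ → true) fa | image-elim g (λ _ → true) gb
  ... | i , _ , refl | j , _ , refl = f~g i j

star-biclique : ∀ {G k} → IsMaxDegree G (suc k) →
  ∃₂ λ A B → Biclique G A B × 1 ≤ countᵇ A × suc k ≤ countᵇ B
star-biclique {G} {k} maxdeg with max-degree-vertex {G} {k} maxdeg
... | v , k<deg =
  (λ a → does (v ≟ a)) , adj G v , centre , countᵇ-witness v (dec-true (v ≟ v) refl) , k<deg
  where
  centre : Biclique G (λ a → does (v ≟ a)) (adj G v)
  centre a b v≡a vb = subst (λ c → adj G c b ≡ true) (does-true (v ≟ a) v≡a) vb

module DirectProduct (G₁ G₂ : Graph) where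

  P : Graph
  P = G₁ ×ᵍ G₂

  π₁ : Fin (n P) → Fin (n G₁)
  π₁ = quotient (n G₂)

  π₂ : Fin (n P) → Fin (n G₂)
  π₂ = remainder {n G₁} (n G₂)

  -- adj P x y unfolds definitionally to adj G₁ (π₁ x) (π₁ y) ∧ adj G₂ (π₂ x) (π₂ y).

  pairs : (Fin (n G₁) → Fin (n G₂) → Bool) → Fin (n P) → Bool
  pairs R x = R (π₁ x) (π₂ x)

  pairs-nonempty : ∀ R a u → R a u ≡ true → ∃ λ x → pairs R x ≡ true
  pairs-nonempty R a u Rau =
    combine a u ,
    subst₂ (λ b v → R b v ≡ true) (sym (quotient-combine a u)) (sym (remainder-combine a u)) Rau

  rectangle-≤-degree : ∀ R x (X : Fin (n G₁) → Bool) (Y : Fin (n G₂) → Bool) →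
    (∀ b v → X b ≡ true → Y v ≡ true → R b v ≡ true) →
    (∀ b → X b ≡ true → adj G₁ (π₁ x) b ≡ true) →
    (∀ v → Y v ≡ true → adj G₂ (π₂ x) v ≡ true) →
    countᵇ X * countᵇ Y ≤ countᵇ (λ y → pairs R y ∧ adj P x y)
  rectangle-≤-degree R x X Y X×Y⊆R X⊆N Y⊆N = rectangle-≤-countᵇ _ X Y λ y Xb Yv →
    cong₂ _∧_ (X×Y⊆R _ _ Xb Yv) (cong₂ _∧_ (X⊆N _ Xb) (Y⊆N _ Yv))

  ×-core : ∀ {k₁ k₂} → HasCore G₁ k₁ → HasCore G₂ k₂ → HasCore P (k₁ * k₂)
  ×-core {k₁} {k₂} (W₁ , (a , W₁a) , k₁≤deg) (W₂ , (u , W₂u) , k₂≤deg) =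
    pairs R , pairs-nonempty R a u (cong₂ _∧_ W₁a W₂u) , deg
    where
    R : Fin (n G₁) → Fin (n G₂) → Bool
    R b v = W₁ b ∧ W₂ v
    deg : ∀ x → pairs R x ≡ true → k₁ * k₂ ≤ countᵇ (λ y → pairs R y ∧ adj P x y)
    deg x Rx = ≤-trans
      (*-mono-≤ (k₁≤deg _ (∧-conicalˡ _ _ Rx)) (k₂≤deg _ (∧-conicalʳ (W₁ (π₁ x)) _ Rx)))
      (rectangle-≤-degree R x (λ b → W₁ b ∧ adj G₁ (π₁ x) b) (λ v → W₂ v ∧ adj G₂ (π₂ x) v)
        (λ b v X₁b Y₂v → cong₂ _∧_ (∧-conicalˡ (W₁ b) _ X₁b) (∧-conicalˡ (W₂ v) _ Y₂v))
        (λ b X₁b → ∧-conicalʳ (W₁ b) _ X₁b)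
        (λ v Y₂v → ∧-conicalʳ (W₂ v) _ Y₂v))

  biclique-core : ∀ {k A₁ B₁ A₂ B₂} → Biclique G₁ A₁ B₁ → Biclique G₂ A₂ B₂ →
    (∃ λ a → A₁ a ≡ true) → (∃ λ v → B₂ v ≡ true) →
    k ≤ countᵇ A₁ * countᵇ B₂ → k ≤ countᵇ B₁ * countᵇ A₂ → HasCore P k
  biclique-core {k} {A₁} {B₁} {A₂} {B₂} K₁ K₂ (a , A₁a) (u , B₂u) k≤A₁B₂ k≤B₁A₂ =
    pairs R , pairs-nonempty R a u (A₁×B₂⊆R a u A₁a B₂u) , deg
    where
    R : Fin (n G₁) → Fin (n G₂) → Bool
    R b v = (A₁ b ∧ B₂ v) ∨ (B₁ b ∧ A₂ v)
    A₁×B₂⊆R : ∀ b v → A₁ b ≡ true → B₂ v ≡ true → R b v ≡ true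
    A₁×B₂⊆R b v A₁b B₂v rewrite A₁b | B₂v = refl
    B₁×A₂⊆R : ∀ b v → B₁ b ≡ true → A₂ v ≡ true → R b v ≡ true
    B₁×A₂⊆R b v B₁b A₂v rewrite B₁b | A₂v = ∨-zeroʳ _
    deg : ∀ x → pairs R x ≡ true → k ≤ countᵇ (λ y → pairs R y ∧ adj P x y)
    deg x Rx with A₁ (π₁ x) ∧ B₂ (π₂ x) in A₁B₂x
    ... | true  = ≤-trans k≤B₁A₂ (rectangle-≤-degree R x B₁ A₂ B₁×A₂⊆R
      (λ b B₁b → K₁ _ b (∧-conicalˡ _ _ A₁B₂x) B₁b)
      (λ v A₂v → trans (Graph.sym G₂ _ v) (K₂ v _ A₂v (∧-conicalʳ (A₁ (π₁ x)) _ A₁B₂x))))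
    ... | false = ≤-trans k≤A₁B₂ (rectangle-≤-degree R x A₁ B₂ A₁×B₂⊆R
      (λ b A₁b → trans (Graph.sym G₁ _ b) (K₁ b _ A₁b (∧-conicalˡ _ _ Rx)))
      (λ v B₂v → K₂ _ v (∧-conicalʳ (B₁ (π₁ x)) _ Rx) B₂v))

  degeneracy-≤ˡ : ∀ {d₁ Δ₂ d} → IsDegeneracy G₁ d₁ → IsMaxDegree G₂ Δ₂ → IsDegeneracy P d →
                  d ≤ d₁ * Δ₂
  degeneracy-≤ˡ {d₁} {Δ₂} degen₁ (deg≤Δ₂ , _) (_ , minimal) = minimal (d₁ * Δ₂) low
    where
    low : (H : Subgraph P) → MinDegreeAtMost H (d₁ * Δ₂)
    low H (y , Sy)
      with low-degree-vertex degen₁ (image π₁ (S H)) (π₁ y , image-intro π₁ (S H) Sy)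
    ... | _ , π₁[S]∋a , small with image-elim π₁ (S H) π₁[S]∋a
    ... | x , Sx , refl = x , Sx , ≤-trans
      (countᵇ-≤-rectangle (E H x) (λ b → image π₁ (S H) b ∧ adj G₁ (π₁ x) b) (adj G₂ (π₂ x))
        λ y e → let (Sy , xy) = edge-in-subgraph H e in
                cong₂ _∧_ (image-intro π₁ (S H) Sy) (∧-conicalˡ _ _ xy) , ∧-conicalʳ _ _ xy)
      (*-mono-≤ small (deg≤Δ₂ (π₂ x)))

  degeneracy-≤ʳ : ∀ {Δ₁ d₂ d} → IsMaxDegree G₁ Δ₁ → IsDegeneracy G₂ d₂ → IsDegeneracy P d →
                  d ≤ Δ₁ * d₂
  degeneracy-≤ʳ {Δ₁} {d₂} (deg≤Δ₁ , _) degen₂ (_ , minimal) = minimal (Δ₁ * d₂) low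
    where
    low : (H : Subgraph P) → MinDegreeAtMost H (Δ₁ * d₂)
    low H (y , Sy)
      with low-degree-vertex degen₂ (image π₂ (S H)) (π₂ y , image-intro π₂ (S H) Sy)
    ... | _ , π₂[S]∋u , small with image-elim π₂ (S H) π₂[S]∋u
    ... | x , Sx , refl = x , Sx , ≤-trans
      (countᵇ-≤-rectangle (E H x) (adj G₁ (π₁ x)) (λ v → image π₂ (S H) v ∧ adj G₂ (π₂ x) v)
        λ y e → let (Sy , xy) = edge-in-subgraph H e in
                ∧-conicalˡ _ _ xy , cong₂ _∧_ (image-intro π₂ (S H) Sy) (∧-conicalʳ _ _ xy))
      (*-mono-≤ (deg≤Δ₁ (π₁ x)) small)

  *-≤-degeneracy : ∀ {d₁ d₂ d} → IsDegeneracy G₁ d₁ → IsDegeneracy G₂ d₂ → IsDegeneracy P d →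
                   d₁ * d₂ ≤ d
  *-≤-degeneracy {zero}               _ _ _ = z≤n
  *-≤-degeneracy {suc d₁} {zero} {d} _ _ _ = subst (_≤ d) (sym (*-zeroʳ (suc d₁))) z≤n
  *-≤-degeneracy {suc _}  {suc _} degen₁ degen₂ degen =
    core-≤-degeneracy degen (×-core (degeneracy-core degen₁) (degeneracy-core degen₂))

  biclique-≤-degeneracy : ∀ {A₁ B₁ A₂ B₂ d} → Biclique G₁ A₁ B₁ → Biclique G₂ A₂ B₂ →
    1 ≤ countᵇ A₁ → 1 ≤ countᵇ B₂ → IsDegeneracy P d →
    (countᵇ A₁ * countᵇ B₂) ⊓ (countᵇ B₁ * countᵇ A₂) ≤ d
  biclique-≤-degeneracy {A₁} {B₁} {A₂} {B₂} K₁ K₂ A₁≢∅ B₂≢∅ degen =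
    core-≤-degeneracy degen (biclique-core K₁ K₂ (1≤countᵇ⇒∃ A₁ A₁≢∅) (1≤countᵇ⇒∃ B₂ B₂≢∅)
                                               (m⊓n≤m _ (countᵇ B₁ * countᵇ A₂))
                                               (m⊓n≤n (countᵇ A₁ * countᵇ B₂) _))

  Kst-≤-degeneracy : ∀ {s₁ t₁ s₂ t₂ d} → ContainsKst G₁ s₁ t₁ → ContainsKst G₂ s₂ t₂ →
    1 ≤ s₁ → 1 ≤ t₂ → IsDegeneracy P d → (s₁ * t₂) ⊓ (s₂ * t₁) ≤ d
  Kst-≤-degeneracy {s₁} {t₁} {s₂} {t₂} {d} K₁ K₂ 1≤s₁ 1≤t₂ degen
    with Kst-biclique {G₁} K₁ | Kst-biclique {G₂} K₂
  ... | A₁ , B₁ , bi₁ , s₁≤A₁ , t₁≤B₁ | A₂ , B₂ , bi₂ , s₂≤A₂ , t₂≤B₂ = begin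
    (s₁ * t₂) ⊓ (s₂ * t₁)
      ≡⟨ cong ((s₁ * t₂) ⊓_) (*-comm s₂ t₁) ⟩
    (s₁ * t₂) ⊓ (t₁ * s₂)
      ≤⟨ ⊓-mono-≤ (*-mono-≤ s₁≤A₁ t₂≤B₂) (*-mono-≤ t₁≤B₁ s₂≤A₂) ⟩
    (countᵇ A₁ * countᵇ B₂) ⊓ (countᵇ B₁ * countᵇ A₂)
      ≤⟨ biclique-≤-degeneracy bi₁ bi₂ (≤-trans 1≤s₁ s₁≤A₁) (≤-trans 1≤t₂ t₂≤B₂) degen ⟩
    d ∎
    where open ≤-Reasoning

  maxDegree-≤-degeneracy : ∀ {Δ₁ Δ₂ d} → IsMaxDegree G₁ Δ₁ → IsMaxDegree G₂ Δ₂ →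
                           IsDegeneracy P d → Δ₁ ⊓ Δ₂ ≤ d
  maxDegree-≤-degeneracy {zero}         _ _ _ = z≤n
  maxDegree-≤-degeneracy {suc _} {zero} _ _ _ = z≤n
  maxDegree-≤-degeneracy {suc k₁} {suc k₂} {d} maxdeg₁ maxdeg₂ degen
    with star-biclique {G₁} maxdeg₁ | star-biclique {G₂} maxdeg₂
  ... | A₁ , B₁ , bi₁ , 1≤A₁ , Δ₁≤B₁ | A₂ , B₂ , bi₂ , 1≤A₂ , Δ₂≤B₂ = begin
    suc k₁ ⊓ suc k₂
      ≡⟨ ⊓-comm (suc k₁) (suc k₂) ⟩
    suc k₂ ⊓ suc k₁
      ≡⟨ cong₂ _⊓_ (*-identityˡ (suc k₂)) (*-identityʳ (suc k₁)) ⟨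
    (1 * suc k₂) ⊓ (suc k₁ * 1)
      ≤⟨ ⊓-mono-≤ (*-mono-≤ 1≤A₁ Δ₂≤B₂) (*-mono-≤ Δ₁≤B₁ 1≤A₂) ⟩
    (countᵇ A₁ * countᵇ B₂) ⊓ (countᵇ B₁ * countᵇ A₂)
      ≤⟨ biclique-≤-degeneracy bi₁ bi₂ 1≤A₁ (≤-trans (s≤s z≤n) Δ₂≤B₂) degen ⟩
    d ∎
    where open ≤-Reasoning

theorem12 : (G₁ G₂ : Graph) (Δ₁ Δ₂ d₁ d₂ s₁ t₁ s₂ t₂ d : ℕ) →
    IsMaxDegree G₁ Δ₁ → IsMaxDegree G₂ Δ₂ →
    IsDegeneracy G₁ d₁ → IsDegeneracy G₂ d₂ →
    1 ≤ s₁ → s₁ ≤ t₁ → 1 ≤ s₂ → s₂ ≤ t₂ →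
    ContainsKst G₁ s₁ t₁ → ContainsKst G₂ s₂ t₂ →
    IsDegeneracy (G₁ ×ᵍ G₂) d →
    ((d₁ * d₂) ⊔ ((s₁ * t₂) ⊓ (s₂ * t₁)) ⊔ (Δ₁ ⊓ Δ₂) ≤ d) ×
    (d ≤ (d₁ * Δ₂) ⊓ (d₂ * Δ₁))
theorem12 G₁ G₂ Δ₁ Δ₂ d₁ d₂ s₁ t₁ s₂ t₂ d
          maxdeg₁ maxdeg₂ degen₁ degen₂ 1≤s₁ _ 1≤s₂ s₂≤t₂ K₁ K₂ degen =
  ⊔-lub (⊔-lub (*-≤-degeneracy degen₁ degen₂ degen)
               (Kst-≤-degeneracy K₁ K₂ 1≤s₁ (≤-trans 1≤s₂ s₂≤t₂) degen))
        (maxDegree-≤-degeneracy maxdeg₁ maxdeg₂ degen) ,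
  ⊓-glb (degeneracy-≤ˡ degen₁ maxdeg₂ degen)
        (subst (d ≤_) (*-comm Δ₁ d₂) (degeneracy-≤ʳ maxdeg₁ degen₂ degen))
  where open DirectProduct G₁ G₂
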